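{- Let $G=(V,E)$ be a graph, $\pi$ an ordering of $V$, and $E_+,E_-$ sets of edges on $V$ (insertions and deletions). Let $E_{\mathrm{new}}=(E\cup E_+)\setminus E_-$ and $E_{\mathrm{all}}=E\cup E_+$. Then $$M(V,E)\,\triangle\,M(V,E_{\mathrm{new}})\subseteq F\big((V,E_{\mathrm{all}}),\emptyset,E_+\cup E_-,1\big),$$ where $F$ is the procedure InfluenceMIS described in the context.
   Context: $M(V,E')$ denotes the lexicographically first MIS of the graph $(V,E')$ with respect to $\pi$ (scan in $\pi$-order, add a vertex iff no neighbor already added); $\triangle$ is symmetric difference. Procedure $F(G,V^?,E^?,i)$ (InfluenceMIS), where $G=(V,E)$ is the current graph, $V^?\subseteq V$ undecided vertices, $E^?\subseteq E$ undecided edges: (1) if $V^?=\emptyset$ and $E^?=\emptyset$, return $\emptyset$. (2) Let $u=\pi(i)$. If $u\notin V$, return $F(G,V^?,E^?,i+1)$. (3) If $u\in V^?$: add every current neighbor of $u$ to $V^?$; delete $u$ from $G,V^?,E^?$; return $\{u\}\cup F(G,V^?,E^?,i+1)$. (4) Otherwise, for each current neighbor $v$ of $u$: if $(u,v)\in E^?$, add $v$ to $V^?$; else delete $v$ from $G,V^?,E^?$. Then delete $u$ from $G,V^?,E^?$ and return $F(G,V^?,E^?,i+1)$. Deleting a vertex from $G$ removes it and its incident edges; deleting it from $E^?$ removes the undecided edges incident to it. -}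

module Defs where

open import Data.Bool using (Bool; true; false; _∧_; _∨_; not; if_then_else_)
open import Data.Nat using (ℕ)
open import Data.Fin using (Fin; _≟_)
open import Data.Fin.Permutation using (Permutation′; _⟨$⟩ʳ_)
open import Data.List using (List; []; _∷_; tabulate; allFin)
open import Data.Bool.ListAction using (any; all)
open import Data.Product using (_×_)
open import Relation.Nullary.Decidable using (⌊_⌋)
open import Relation.Binary.PropositionalEquality using (_≡_)

-- Vertex set is V = Fin n.  A vertex subset is a Boolean predicate,
-- an (undirected) edge set is a Boolean relation (required symmetric
-- and irreflexive where it denotes a set of edges).
VSet : ℕ → Set
VSet n = Fin n → Bool

ERel : ℕ → Set
ERel n = Fin n → Fin n → Bool

IsEdgeSet : ∀ {n} → ERel n → Set
IsEdgeSet {n} E = (∀ (x y : Fin n) → E x y ≡ E y x) × (∀ (x : Fin n) → E x x ≡ false)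

eqb : ∀ {n} → Fin n → Fin n → Bool
eqb x y = ⌊ x ≟ y ⌋

order : ∀ {n} → Permutation′ n → List (Fin n)
order π = tabulate (π ⟨$⟩ʳ_)

lfmisGo : ∀ {n} → ERel n → List (Fin n) → VSet n → VSet n
lfmisGo E [] S = S
lfmisGo {n} E (u ∷ us) S =
  if any (λ v → E u v ∧ S v) (allFin n)
  then lfmisGo E us S
  else lfmisGo E us (λ w → S w ∨ eqb w u)

M : ∀ {n} → ERel n → Permutation′ n → VSet n
M E π = lfmisGo E (order π) (λ _ → false)

emptyV : ∀ {n} → VSet n → Bool
emptyV {n} S = all (λ v → not (S v)) (allFin n)

emptyE : ∀ {n} → ERel n → Bool
emptyE {n} R = all (λ x → all (λ y → not (R x y)) (allFin n)) (allFin n)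

-- The current graph G is given by the fixed edge relation
-- Eg restricted to the current vertex set Vg (deleting a vertex from G
-- removes it from Vg, hence all its incident edges).  Vq = V^?, Eq = E^?.
-- The list argument is the remaining part of the π-order (π(i), π(i+1), ...).
influenceGo : ∀ {n} → ERel n → List (Fin n) → VSet n → VSet n → ERel n → VSet n
influenceGo Eg [] Vg Vq Eq = λ _ → false
influenceGo Eg (u ∷ us) Vg Vq Eq =
  if emptyV Vq ∧ emptyE Eq then (λ _ → false)                       -- (1)
  else if not (Vg u) then influenceGo Eg us Vg Vq Eq                -- (2)
  else if Vq u                                                      -- (3)
  then (λ w → eqb w u ∨
          influenceGo Eg us
            (λ w → Vg w ∧ not (eqb w u))
            (λ w → (Vq w ∨ nbr w) ∧ not (eqb w u))
            (λ x y → Eq x y ∧ not (eqb x u) ∧ not (eqb y u)) w)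
  else influenceGo Eg us                                            -- (4)
         (λ w → Vg w ∧ keep w)
         (λ w → (Vq w ∨ (nbr w ∧ Eq u w)) ∧ keep w)
         (λ x y → Eq x y ∧ keep x ∧ keep y)
  where
  nbr : _ → Bool
  nbr w = Vg w ∧ Eg u w
  -- w survives step (4): not u, and not a neighbour joined by a decided edge
  keep : _ → Bool
  keep w = not (eqb w u) ∧ not (nbr w ∧ not (Eq u w))

-- F(G, V^?, E^?, 1) with G = (V, Eg)
F : ∀ {n} → Permutation′ n → ERel n → VSet n → ERel n → VSet n
F {n} π Eg Vq Eq = influenceGo Eg (order π) (λ _ → true) Vq Eq

{-# OPTIONS --safe #-}
-- Both E and E_new lie between E_all minus the changed edges D = E₊ ∪ E₋ and E_all (Between).
-- Run the greedy scans for M(V,E) and M(V,E_new) in lockstep with InfluenceMIS on (V,E_all),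
-- keeping the invariant that every vertex deleted from G is already dominated in both scans,
-- every vertex of G outside V? is dominated in neither, and every edge of G outside E? is not in D
-- (Tracks, Decided).  At a vertex u of G outside V? both scans therefore add u; its neighbours
-- across edges outside E? are joined to u in both graphs, so they are dominated and may be deleted,
-- while the others become undecided.  At u ∈ V? the scans may disagree on u, so F outputs u and
-- makes all its neighbours undecided.  Hence the scans differ only on outputs of F.  The early
-- exit (1) loses nothing: once V? and E? are empty, the procedure without it outputs nothing more.
module Submission where

open import Defs
open import Data.Bool using (Bool; true; false; _∧_; _∨_; not; _xor_; if_then_else_)
open import Data.Bool.Properties
  using (∧-conicalˡ; ∧-conicalʳ; ∨-conicalˡ; ∨-conicalʳ; ∧-identityʳ; ∧-zeroʳ; ∨-identityʳ; ∨-zeroʳ;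
         not-involutive; if-float; T-≡; T-∧)
open import Data.Bool.ListAction using (any; all)
open import Data.Fin using (Fin; _≟_)
open import Data.Fin.Permutation using (Permutation′)
open import Data.List using (List; []; _∷_; allFin)
open import Data.List.Membership.Propositional using (_∈_; lose)
open import Data.List.Membership.Propositional.Properties using (∈-allFin)
open import Data.List.Relation.Unary.All as All using (All)
open import Data.List.Relation.Unary.All.Properties using (all⁺)
open import Data.List.Relation.Unary.Any using (here; there; satisfied)
open import Data.List.Relation.Unary.Any.Properties using (any⁺; any⁻)
open import Data.List.Relation.Unary.AllPairs using (_∷_)
open import Data.List.Relation.Unary.Unique.Propositional using (Unique)
open import Data.List.Relation.Unary.Unique.Propositional.Properties using (tabulate⁺)
open import Data.Nat using (ℕ)
open import Data.Product using (∃-syntax; _×_; _,_)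
open import Data.Sum using (_⊎_; inj₁; inj₂)
open import Function using (Injection; Equivalence)
open import Function.Properties.Inverse using (↔⇒↣)
open import Relation.Binary.PropositionalEquality
  using (_≡_; _≢_; refl; sym; trans; cong; cong₂; ≢-sym)
open import Relation.Nullary using (¬_; yes; no; contradiction)
open import Relation.Nullary.Decidable using (isYes≗does; dec-true; dec-false)

private
  variable
    n : ℕ

not-flip : ∀ {x y} → not x ≡ y → x ≡ not y
not-flip {x} refl = sym (not-involutive x)

x∧y≡false⇒y≡true⇒x≡false : ∀ {x y} → x ∧ y ≡ false → y ≡ true → x ≡ false
x∧y≡false⇒y≡true⇒x≡false {x} x∧true≡false refl = trans (sym (∧-identityʳ x)) x∧true≡false

x∧y≡false⇒x∧¬y≡false⇒x≡false : ∀ {x y} → x ∧ y ≡ false → x ∧ not y ≡ false → x ≡ false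
x∧y≡false⇒x∧¬y≡false⇒x≡false {false} _ _ = refl
x∧y≡false⇒x∧¬y≡false⇒x≡false {true} {false} _ ()

x∨y≡true⇒y≡false⇒x≡true : ∀ {x y} → x ∨ y ≡ true → y ≡ false → x ≡ true
x∨y≡true⇒y≡false⇒x≡true {true} _ _ = refl
x∨y≡true⇒y≡false⇒x≡true {false} refl ()

∧≡false-cases : ∀ x {y} → x ∧ y ≡ false → x ≡ false ⊎ y ≡ false
∧≡false-cases false _ = inj₁ refl
∧≡false-cases true y≡false = inj₂ y≡false

xor≡true⇒≢ : ∀ {x y} → x xor y ≡ true → x ≢ y
xor≡true⇒≢ {false} () refl
xor≡true⇒≢ {true} () refl

eqb-refl : (x : Fin n) → eqb x x ≡ true
eqb-refl x = trans (isYes≗does (x ≟ x)) (dec-true (x ≟ x) refl)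

eqb-≢ : {x y : Fin n} → x ≢ y → eqb x y ≡ false
eqb-≢ {x = x} {y} x≢y = trans (isYes≗does (x ≟ y)) (dec-false (x ≟ y) x≢y)

eqb≡false⇒≢ : {x y : Fin n} → eqb x y ≡ false → x ≢ y
eqb≡false⇒≢ {x = x} eqb≡false refl = contradiction (trans (sym eqb≡false) (eqb-refl x)) λ ()

all-allFin-elim : {p : Fin n → Bool} → all p (allFin n) ≡ true → ∀ x → p x ≡ true
all-allFin-elim {n} h x =
  Equivalence.to T-≡ (All.lookup (all⁺ _ (allFin n) (Equivalence.from T-≡ h)) (∈-allFin x))

emptyV⇒≡false : {S : VSet n} → emptyV S ≡ true → ∀ w → S w ≡ false
emptyV⇒≡false h w = not-flip (all-allFin-elim h w)

emptyE⇒≡false : {R : ERel n} → emptyE R ≡ true → ∀ x y → R x y ≡ false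
emptyE⇒≡false {R = R} h x = emptyV⇒≡false {S = R x} (all-allFin-elim h x)

order-unique : (π : Permutation′ n) → Unique (order π)
order-unique π = tabulate⁺ (Injection.injective (↔⇒↣ π))

blocked : ERel n → VSet n → Fin n → Bool
blocked {n} E S u = any (λ x → E u x ∧ S x) (allFin n)

insert : VSet n → Fin n → VSet n
insert S u w = S w ∨ eqb w u

scanStep : ERel n → VSet n → Fin n → VSet n
scanStep E S u = if blocked E S u then S else insert S u

module _ {S : VSet n} {u : Fin n} where

  insert-self : insert S u u ≡ true
  insert-self = trans (cong (S u ∨_) (eqb-refl u)) (∨-zeroʳ (S u))

  insert-⊇ : ∀ {w} → S w ≡ true → insert S u w ≡ true
  insert-⊇ {w} Sw = cong (_∨ eqb w u) Sw

  insert-≢ : ∀ {w} → w ≢ u → insert S u w ≡ S w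
  insert-≢ {w} w≢u = trans (cong (S w ∨_) (eqb-≢ w≢u)) (∨-identityʳ (S w))

Dominated : ERel n → VSet n → Fin n → Set
Dominated E S w = ∃[ x ] E w x ≡ true × S x ≡ true

module _ {E : ERel n} {S : VSet n} {w : Fin n} where

  dominated⇒blocked : Dominated E S w → blocked E S w ≡ true
  dominated⇒blocked (x , Ewx , Sx) =
    Equivalence.to T-≡ (any⁺ _ (lose (∈-allFin x) (Equivalence.from T-≡ (cong₂ _∧_ Ewx Sx))))

  blocked⇒dominated : blocked E S w ≡ true → Dominated E S w
  blocked⇒dominated b with satisfied (any⁻ _ (allFin n) (Equivalence.from T-≡ b))
  ... | x , T[Ewx∧Sx] with Equivalence.to (T-∧ {E w x}) T[Ewx∧Sx]
  ...   | T[Ewx] , T[Sx] = x , Equivalence.to T-≡ T[Ewx] , Equivalence.to T-≡ T[Sx]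

  undominated⇒unblocked : ¬ Dominated E S w → blocked E S w ≡ false
  undominated⇒unblocked ¬dom with blocked E S w in b
  ... | true = contradiction (blocked⇒dominated b) ¬dom
  ... | false = refl

module _ {E : ERel n} {S : VSet n} {u : Fin n} where

  lfmisGo-dominated : ∀ {us} → Dominated E S u → lfmisGo E (u ∷ us) S ≡ lfmisGo E us S
  lfmisGo-dominated {us} dom =
    cong (λ b → if b then lfmisGo E us S else lfmisGo E us (insert S u))
      (dominated⇒blocked {E = E} {S} {u} dom)

  lfmisGo-undominated : ∀ {us} → ¬ Dominated E S u →
    lfmisGo E (u ∷ us) S ≡ lfmisGo E us (insert S u)
  lfmisGo-undominated {us} ¬dom =
    cong (λ b → if b then lfmisGo E us S else lfmisGo E us (insert S u))
      (undominated⇒unblocked {E = E} {S} {u} ¬dom)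

  lfmisGo-scanStep : ∀ us → lfmisGo E (u ∷ us) S ≡ lfmisGo E us (scanStep E S u)
  lfmisGo-scanStep us = sym (if-float (lfmisGo E us) (blocked E S u))

  scanStep-⊇ : ∀ {w} → S w ≡ true → scanStep E S u w ≡ true
  scanStep-⊇ Sw with blocked E S u
  ... | true = Sw
  ... | false = insert-⊇ {S = S} Sw

  scanStep-≢ : ∀ {w} → w ≢ u → scanStep E S u w ≡ S w
  scanStep-≢ w≢u with blocked E S u
  ... | true = refl
  ... | false = insert-≢ {S = S} w≢u

dominated-mono : {E : ERel n} {S S′ : VSet n} {w : Fin n} →
  (∀ {x} → S x ≡ true → S′ x ≡ true) → Dominated E S w → Dominated E S′ w
dominated-mono S⊆S′ (x , Ewx , Sx) = x , Ewx , S⊆S′ Sx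

undominated-off : {E : ERel n} {S S′ : VSet n} {u w : Fin n} → E w u ≡ false →
  (∀ {x} → x ≢ u → S′ x ≡ S x) → ¬ Dominated E S w → ¬ Dominated E S′ w
undominated-off {u = u} Ewu≡false S′≗S ¬dom (x , Ewx , S′x) with x ≟ u
... | yes refl = contradiction (trans (sym Ewx) Ewu≡false) λ ()
... | no x≢u = ¬dom (x , Ewx , trans (sym (S′≗S x≢u)) S′x)

-- Current graph, V? and E? after step (3) (subscript ₃) or step (4) (subscript ₄) at vertex u;
-- they unfold to the expressions in influenceGo.
module InfluenceStep (Eg : ERel n) (Vg Vq : VSet n) (Eq : ERel n) (u : Fin n) where

  neighbour : VSet n
  neighbour w = Vg w ∧ Eg u w

  keep : VSet n
  keep w = not (eqb w u) ∧ not (neighbour w ∧ not (Eq u w))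

  Vg₃ Vq₃ Vg₄ Vq₄ : VSet n
  Vg₃ w = Vg w ∧ not (eqb w u)
  Vq₃ w = (Vq w ∨ neighbour w) ∧ not (eqb w u)
  Vg₄ w = Vg w ∧ keep w
  Vq₄ w = (Vq w ∨ (neighbour w ∧ Eq u w)) ∧ keep w

  Eq₃ Eq₄ : ERel n
  Eq₃ x y = Eq x y ∧ not (eqb x u) ∧ not (eqb y u)
  Eq₄ x y = Eq x y ∧ keep x ∧ keep y

  module _ {w : Fin n} (w≢u : w ≢ u) where

    ∧-not-eqb : ∀ x → x ∧ not (eqb w u) ≡ x
    ∧-not-eqb x = trans (cong (λ b → x ∧ not b) (eqb-≢ w≢u)) (∧-identityʳ x)

    Vg₃-≢ : Vg₃ w ≡ Vg w
    Vg₃-≢ = ∧-not-eqb (Vg w)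

    Vq₃-≢ : Vq₃ w ≡ Vq w ∨ neighbour w
    Vq₃-≢ = ∧-not-eqb (Vq w ∨ neighbour w)

    keep-≢ : keep w ≡ not (neighbour w ∧ not (Eq u w))
    keep-≢ = cong (λ b → not b ∧ not (neighbour w ∧ not (Eq u w))) (eqb-≢ w≢u)

influenceGoNoExit : ERel n → List (Fin n) → VSet n → VSet n → ERel n → VSet n
influenceGoNoExit Eg [] Vg Vq Eq = λ _ → false
influenceGoNoExit Eg (u ∷ us) Vg Vq Eq =
  if not (Vg u) then influenceGoNoExit Eg us Vg Vq Eq
  else if Vq u then (λ w → eqb w u ∨ influenceGoNoExit Eg us Vg₃ Vq₃ Eq₃ w)
  else influenceGoNoExit Eg us Vg₄ Vq₄ Eq₄
  where open InfluenceStep Eg Vg Vq Eq u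

influenceGoNoExit-silent : ∀ {Eg : ERel n} us {Vg Vq Eq v} →
  (∀ w → Vq w ≡ false) → (∀ x y → Eq x y ≡ false) → influenceGoNoExit Eg us Vg Vq Eq v ≡ false
influenceGoNoExit-silent [] _ _ = refl
influenceGoNoExit-silent {Eg = Eg} (u ∷ us) {Vg} {Vq} {Eq} noVq noEq with Vg u
... | false = influenceGoNoExit-silent us {Vg} {Vq} {Eq} noVq noEq
... | true rewrite noVq u =
  influenceGoNoExit-silent us {Vg₄} {Vq₄} {Eq₄} noVq₄
    (λ x y → cong (_∧ keep x ∧ keep y) (noEq x y))
  where
  open InfluenceStep Eg Vg Vq Eq u
  noVq₄ : ∀ w → Vq₄ w ≡ false
  noVq₄ w rewrite noVq w | noEq u w | ∧-zeroʳ (neighbour w) = refl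

influenceGoNoExit⇒influenceGo : ∀ {Eg : ERel n} us {Vg Vq Eq v} →
  influenceGoNoExit Eg us Vg Vq Eq v ≡ true → influenceGo Eg us Vg Vq Eq v ≡ true
influenceGoNoExit⇒influenceGo {Eg = Eg} (u ∷ us) {Vg} {Vq} {Eq} {v} out
  with emptyV Vq ∧ emptyE Eq in exit
... | true = contradiction (trans (sym out) silent) λ ()
  where
  silent : influenceGoNoExit Eg (u ∷ us) Vg Vq Eq v ≡ false
  silent = influenceGoNoExit-silent (u ∷ us) {Vg} {Vq} {Eq}
    (emptyV⇒≡false (∧-conicalˡ _ _ exit)) (emptyE⇒≡false (∧-conicalʳ _ _ exit))
... | false with Vg u
...   | false = influenceGoNoExit⇒influenceGo us {Vg} {Vq} {Eq} out
...   | true with Vq u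
...     | false = influenceGoNoExit⇒influenceGo us {Vg₄} {Vq₄} {Eq₄} out
  where open InfluenceStep Eg Vg Vq Eq u
...     | true with eqb v u
...       | true = refl
...       | false = influenceGoNoExit⇒influenceGo us {Vg₃} {Vq₃} {Eq₃} out
  where open InfluenceStep Eg Vg Vq Eq u

record Tracks (E : ERel n) (S : VSet n) (us : List (Fin n)) (Vg Vq : VSet n) : Set where
  field
    deleted⇒dominated : ∀ {w} → w ∈ us → Vg w ≡ false → Dominated E S w
    decided⇒undominated : ∀ {w} → w ∈ us → Vg w ≡ true → Vq w ≡ false → ¬ Dominated E S w

open Tracks

Decided : ERel n → VSet n → ERel n → Set
Decided D Vg Eq = ∀ {x y} → Vg x ≡ true → Vg y ≡ true → Eq x y ≡ false → D x y ≡ false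

decided-restrict : {D Eq : ERel n} {Vg : VSet n} (k : VSet n) →
  Decided D Vg Eq → Decided D (λ w → Vg w ∧ k w) (λ x y → Eq x y ∧ k x ∧ k y)
decided-restrict {Eq = Eq} {Vg} k decided {x} {y} Vgx∧kx Vgy∧ky Eqxy∧kx∧ky =
  decided (∧-conicalˡ (Vg x) (k x) Vgx∧kx) (∧-conicalˡ (Vg y) (k y) Vgy∧ky)
    (x∧y≡false⇒y≡true⇒x≡false Eqxy∧kx∧ky
      (cong₂ _∧_ (∧-conicalʳ (Vg x) (k x) Vgx∧kx) (∧-conicalʳ (Vg y) (k y) Vgy∧ky)))

record Between (Ea D E : ERel n) : Set where
  field
    symmetric : ∀ x y → E x y ≡ E y x
    ⊆-all : ∀ {x y} → E x y ≡ true → Ea x y ≡ true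
    unchanged : ∀ {x y} → Ea x y ≡ true → D x y ≡ false → E x y ≡ true

tracks-tail : {E : ERel n} {S Vg Vq : VSet n} {u : Fin n} {us : List (Fin n)} →
  Tracks E S (u ∷ us) Vg Vq → Tracks E S us Vg Vq
tracks-tail t = record
  { deleted⇒dominated = λ w∈us → deleted⇒dominated t (there w∈us)
  ; decided⇒undominated = λ w∈us → decided⇒undominated t (there w∈us)
  }

module Scan {Ea D E : ERel n} (between : Between Ea D E) where
  open Between between

  nonadjacent : ∀ {u w} → Ea u w ≡ false → E w u ≡ false
  nonadjacent {u} {w} Eauw≡false with E w u in Ewu
  ... | true = contradiction (trans (sym (⊆-all (trans (symmetric u w) Ewu))) Eauw≡false) λ ()
  ... | false = refl

  module _ {Vg Vq : VSet n} {Eq : ERel n} {u : Fin n} {us : List (Fin n)}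
           (u∉us : All (u ≢_) us) where
    open InfluenceStep Ea Vg Vq Eq u

    private
      ≢u : ∀ {w} → w ∈ us → w ≢ u
      ≢u w∈us = ≢-sym (All.lookup u∉us w∈us)

    tracks-undecided : {S S′ : VSet n} →
      (∀ {x} → S x ≡ true → S′ x ≡ true) → (∀ {x} → x ≢ u → S′ x ≡ S x) →
      Tracks E S (u ∷ us) Vg Vq → Tracks E S′ us Vg₃ Vq₃
    tracks-undecided {S} {S′} S⊆S′ S′≗S t = record
      { deleted⇒dominated = deleted⇒dominated₃
      ; decided⇒undominated = decided⇒undominated₃
      }
      where
      deleted⇒dominated₃ : ∀ {w} → w ∈ us → Vg₃ w ≡ false → Dominated E S′ w
      deleted⇒dominated₃ w∈us Vg₃w =
        dominated-mono {E = E} S⊆S′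
          (deleted⇒dominated t (there w∈us) (trans (sym (Vg₃-≢ (≢u w∈us))) Vg₃w))

      decided⇒undominated₃ : ∀ {w} → w ∈ us → Vg₃ w ≡ true → Vq₃ w ≡ false → ¬ Dominated E S′ w
      decided⇒undominated₃ {w} w∈us Vg₃w Vq₃w =
        undominated-off {E = E} (nonadjacent Eauw) S′≗S (decided⇒undominated t (there w∈us) Vgw Vqw)
        where
        Vgw = trans (sym (Vg₃-≢ (≢u w∈us))) Vg₃w
        Vq∨nb = trans (sym (Vq₃-≢ (≢u w∈us))) Vq₃w
        Vqw = ∨-conicalˡ (Vq w) (neighbour w) Vq∨nb
        Eauw = trans (cong (_∧ Ea u w) (sym Vgw)) (∨-conicalʳ (Vq w) (neighbour w) Vq∨nb)

    tracks-decided : {S : VSet n} → Decided D Vg Eq → Vg u ≡ true →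
      Tracks E S (u ∷ us) Vg Vq → Tracks E (insert S u) us Vg₄ Vq₄
    tracks-decided {S} decided Vgu t = record
      { deleted⇒dominated = deleted⇒dominated₄
      ; decided⇒undominated = decided⇒undominated₄
      }
      where
      deleted⇒dominated₄ : ∀ {w} → w ∈ us → Vg₄ w ≡ false → Dominated E (insert S u) w
      deleted⇒dominated₄ {w} w∈us Vg₄w with ∧≡false-cases (Vg w) Vg₄w
      ... | inj₁ Vgw≡false =
        dominated-mono {E = E} (insert-⊇ {S = S}) (deleted⇒dominated t (there w∈us) Vgw≡false)
      ... | inj₂ keepw≡false = u , Ewu , insert-self {S = S}
        where
        nb∧¬Eq = not-flip (trans (sym (keep-≢ (≢u w∈us))) keepw≡false)
        nb = ∧-conicalˡ (neighbour w) (not (Eq u w)) nb∧¬Eq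
        Equw≡false = not-flip (∧-conicalʳ (neighbour w) (not (Eq u w)) nb∧¬Eq)
        Duw≡false = decided Vgu (∧-conicalˡ (Vg w) (Ea u w) nb) Equw≡false
        Ewu = trans (symmetric w u) (unchanged (∧-conicalʳ (Vg w) (Ea u w) nb) Duw≡false)

      decided⇒undominated₄ : ∀ {w} → w ∈ us → Vg₄ w ≡ true → Vq₄ w ≡ false →
        ¬ Dominated E (insert S u) w
      decided⇒undominated₄ {w} w∈us Vg₄w Vq₄w =
        undominated-off {E = E} (nonadjacent Eauw) (insert-≢ {S = S})
          (decided⇒undominated t (there w∈us) Vgw Vqw)
        where
        Vgw = ∧-conicalˡ (Vg w) (keep w) Vg₄w
        keepw = ∧-conicalʳ (Vg w) (keep w) Vg₄w
        Vq∨nb∧Eq = x∧y≡false⇒y≡true⇒x≡false Vq₄w keepw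
        Vqw = ∨-conicalˡ (Vq w) (neighbour w ∧ Eq u w) Vq∨nb∧Eq
        nb∧Eq = ∨-conicalʳ (Vq w) (neighbour w ∧ Eq u w) Vq∨nb∧Eq
        nb∧¬Eq = not-flip (trans (sym (keep-≢ (≢u w∈us))) keepw)
        Eauw = trans (cong (_∧ Ea u w) (sym Vgw)) (x∧y≡false⇒x∧¬y≡false⇒x≡false nb∧Eq nb∧¬Eq)

tracks-empty : {E : ERel n} {us : List (Fin n)} →
  Tracks E (λ _ → false) us (λ _ → true) (λ _ → false)
tracks-empty = record
  { deleted⇒dominated = λ _ ()
  ; decided⇒undominated = λ _ _ _ ()
  }

module Agreement {Ea D E₁ E₂ : ERel n}
                 (between₁ : Between Ea D E₁) (between₂ : Between Ea D E₂) where
  private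
    module Scan₁ = Scan between₁
    module Scan₂ = Scan between₂

  lfmisGo-agree : ∀ {us} → Unique us → ∀ {Vg Vq Eq S₁ S₂ v} →
    Tracks E₁ S₁ us Vg Vq → Tracks E₂ S₂ us Vg Vq → Decided D Vg Eq →
    influenceGoNoExit Ea us Vg Vq Eq v ≡ false → S₁ v ≡ S₂ v →
    lfmisGo E₁ us S₁ v ≡ lfmisGo E₂ us S₂ v
  lfmisGo-agree {us = []} _ _ _ _ _ S₁v≡S₂v = S₁v≡S₂v
  lfmisGo-agree {us = u ∷ us} (u∉us ∷ unique) {Vg} {Vq} {Eq} {S₁} {S₂} {v}
    t₁ t₂ decided out S₁v≡S₂v
    with Vg u in Vgu | Vq u in Vqu
  ... | false | _
    rewrite lfmisGo-dominated {E = E₁} {S₁} {u} {us} (deleted⇒dominated t₁ (here refl) Vgu)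
          | lfmisGo-dominated {E = E₂} {S₂} {u} {us} (deleted⇒dominated t₂ (here refl) Vgu)
    = lfmisGo-agree unique (tracks-tail t₁) (tracks-tail t₂) decided out S₁v≡S₂v
  ... | true | true
    rewrite lfmisGo-scanStep {E = E₁} {S₁} {u} us | lfmisGo-scanStep {E = E₂} {S₂} {u} us
    = lfmisGo-agree unique {Vg₃} {Vq₃} {Eq₃}
        (Scan₁.tracks-undecided {Eq = Eq} u∉us (scanStep-⊇ {E = E₁}) (scanStep-≢ {E = E₁}) t₁)
        (Scan₂.tracks-undecided {Eq = Eq} u∉us (scanStep-⊇ {E = E₂}) (scanStep-≢ {E = E₂}) t₂)
        (decided-restrict (λ w → not (eqb w u)) decided)
        (∨-conicalʳ (eqb v u) _ out)
        (trans (scanStep-≢ {E = E₁} v≢u) (trans S₁v≡S₂v (sym (scanStep-≢ {E = E₂} v≢u))))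
    where
    open InfluenceStep Ea Vg Vq Eq u
    v≢u = eqb≡false⇒≢ (∨-conicalˡ (eqb v u) _ out)
  ... | true | false
    rewrite lfmisGo-undominated {E = E₁} {S₁} {u} {us}
              (decided⇒undominated t₁ (here refl) Vgu Vqu)
          | lfmisGo-undominated {E = E₂} {S₂} {u} {us}
              (decided⇒undominated t₂ (here refl) Vgu Vqu)
    = lfmisGo-agree unique {Vg₄} {Vq₄} {Eq₄}
        (Scan₁.tracks-decided u∉us decided Vgu t₁)
        (Scan₂.tracks-decided u∉us decided Vgu t₂)
        (decided-restrict keep decided)
        out
        (cong (_∨ eqb v u) S₁v≡S₂v)
    where open InfluenceStep Ea Vg Vq Eq u

  M-xor⇒F : (π : Permutation′ n) {v : Fin n} →
    (M E₁ π v xor M E₂ π v) ≡ true → F π Ea (λ _ → false) D v ≡ true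
  M-xor⇒F π {v} differ
    with influenceGoNoExit Ea (order π) (λ _ → true) (λ _ → false) D v in out
  ... | true = influenceGoNoExit⇒influenceGo (order π) out
  ... | false = contradiction
    (lfmisGo-agree (order-unique π) tracks-empty tracks-empty (λ _ _ D≡false → D≡false) out refl)
    (xor≡true⇒≢ differ)

module _ {E E₊ E₋ : ERel n} where

  private
    Eall Enew D : ERel n
    Eall x y = E x y ∨ E₊ x y
    Enew x y = Eall x y ∧ not (E₋ x y)
    D x y = E₊ x y ∨ E₋ x y

  between-old : (∀ x y → E x y ≡ E y x) → Between Eall D E
  between-old E-sym = record
    { symmetric = E-sym
    ; ⊆-all = λ {x} {y} Exy → cong (_∨ E₊ x y) Exy
    ; unchanged = λ {x} {y} Eallxy Dxy →
        x∨y≡true⇒y≡false⇒x≡true Eallxy (∨-conicalˡ (E₊ x y) (E₋ x y) Dxy)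
    }

  between-new : (∀ x y → E x y ≡ E y x) → (∀ x y → E₊ x y ≡ E₊ y x) → (∀ x y → E₋ x y ≡ E₋ y x) →
    Between Eall D Enew
  between-new E-sym E₊-sym E₋-sym = record
    { symmetric = λ x y →
        cong₂ (λ a b → a ∧ not b) (cong₂ _∨_ (E-sym x y) (E₊-sym x y)) (E₋-sym x y)
    ; ⊆-all = λ {x} {y} → ∧-conicalˡ (Eall x y) (not (E₋ x y))
    ; unchanged = λ {x} {y} Eallxy Dxy →
        cong₂ _∧_ Eallxy (cong not (∨-conicalʳ (E₊ x y) (E₋ x y) Dxy))
    }

mainTheorem7 : (n : ℕ) (π : Permutation′ n) (E E₊ E₋ : ERel n) →
    IsEdgeSet E → IsEdgeSet E₊ → IsEdgeSet E₋ →
    (v : Fin n) →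
    (M E π v xor M (λ x y → (E x y ∨ E₊ x y) ∧ not (E₋ x y)) π v) ≡ true →
    F π (λ x y → E x y ∨ E₊ x y) (λ _ → false) (λ x y → E₊ x y ∨ E₋ x y) v ≡ true
mainTheorem7 n π E E₊ E₋ (E-sym , _) (E₊-sym , _) (E₋-sym , _) v =
  M-xor⇒F π
  where open Agreement (between-old E-sym) (between-new E-sym E₊-sym E₋-sym)
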